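{- Let $w\in\Delta$ and let $\mathcal{R}=\mathcal{D}+[0,N]w$ be a cylinder with axis $w$, base $\mathcal{D}\subset\pi$ and even depth $N$, where $\pi$ is a basic plane with normal $w$. Let $Q\subset\pi$ be a unit square with vertices in $\mathbb{Z}^3$ that is not contained in $\mathcal{D}$, let $t$ be a tiling of $\mathcal{R}$ and let $u\in\Phi$. Then $$\sum_{d\in t,\ d\cap S^u(Q+[0,N]w)\neq\emptyset}\det(v(d),w,u)=0.$$
   Context: A basic cube is $(x,y,z)+[0,1]^3$, $(x,y,z)\in\mathbb{Z}^3$, black if $x+y+z$ odd, white if even. A domino is the union of two basic cubes sharing a face; a tiling of a region is a set of dominoes with pairwise disjoint interiors whose union is the region. $\Phi=\{\pm e_x,\pm e_y,\pm e_z\}$, $\Delta=\{e_x,e_y,e_z\}$. For a domino $d$, $v(d)\in\Phi$ is the center of its black cube minus the center of its white cube; $\det(a,b,c)=a\cdot(b\times c)$. For $X\subset\mathbb{R}^3$, $S^u(X)=\operatorname{int}\big((X+[0,\infty)u)\setminus X\big)$. A basic plane is $\{x=k\}$, $\{y=k\}$ or $\{z=k\}$ with $k\in\mathbb{Z}$. A cylinder with base $\mathcal{D}$, axis $w$ and depth $N$ is $\mathcal{D}+[0,N]w$, where $\mathcal{D}$ is a finite union of unit squares with vertices in $\mathbb{Z}^3$ in a basic plane with normal $w$, and $\mathcal{D}$ is simply connected with connected interior. -}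

module Defs where

open import Data.Bool using (Bool; if_then_else_)
open import Data.Nat as ℕ using (ℕ; suc; _<_; _%_; _≡ᵇ_)
open import Data.Integer using (ℤ; +_; -_; _+_; _-_; _*_; ∣_∣; 0ℤ; 1ℤ)
open import Data.List using (List; []; _∷_; concatMap)
open import Data.List.Membership.Propositional using (_∈_; _∉_)
open import Data.List.Relation.Unary.Any using (Any)
open import Data.List.Relation.Unary.Unique.Propositional using (Unique)
open import Data.Product using (Σ; ∃; _×_; _,_)
open import Relation.Binary.PropositionalEquality using (_≡_; _≢_)
open import Relation.Nullary using (¬_)

-- Axes, directions.  Δ = {e_x, e_y, e_z} is represented by Axis,
-- Φ = {±e_x, ±e_y, ±e_z} by Dir.

data Axis : Set where
  ax ay az : Axis

data Sign : Set where
  pos neg : Sign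

record Dir : Set where
  constructor dir
  field
    axis : Axis
    sign : Sign

record ℤ³ : Set where
  constructor ⟨_,_,_⟩
  field
    x y z : ℤ
open ℤ³ public

_⊕_ : ℤ³ → ℤ³ → ℤ³
⟨ a , b , c ⟩ ⊕ ⟨ a' , b' , c' ⟩ = ⟨ a + a' , b + b' , c + c' ⟩

_·_ : ℤ → ℤ³ → ℤ³
s · ⟨ a , b , c ⟩ = ⟨ s * a , s * b , s * c ⟩

neg³ : ℤ³ → ℤ³
neg³ v = (- 1ℤ) · v

e : Axis → ℤ³
e ax = ⟨ 1ℤ , 0ℤ , 0ℤ ⟩
e ay = ⟨ 0ℤ , 1ℤ , 0ℤ ⟩
e az = ⟨ 0ℤ , 0ℤ , 1ℤ ⟩

vec : Dir → ℤ³
vec (dir i pos) = e i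
vec (dir i neg) = neg³ (e i)

coord : Axis → ℤ³ → ℤ
coord ax p = x p
coord ay p = y p
coord az p = z p

dot : ℤ³ → ℤ³ → ℤ
dot ⟨ a , b , c ⟩ ⟨ a' , b' , c' ⟩ = a * a' + b * b' + c * c'

cross : ℤ³ → ℤ³ → ℤ³
cross ⟨ a , b , c ⟩ ⟨ a' , b' , c' ⟩ =
  ⟨ b * c' - c * b' , c * a' - a * c' , a * b' - b * a' ⟩

det : ℤ³ → ℤ³ → ℤ³ → ℤ
det a b c = dot a (cross b c)

-- Basic cubes: the cube (x,y,z)+[0,1]^3 is represented by (x,y,z).

Cube : Set
Cube = ℤ³

isBlack : Cube → Bool
isBlack c = (∣ x c + y c + z c ∣ % 2) ≡ᵇ 1

-- A domino: the union of the basic cubes  base  and  base + e_axis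
-- (every domino has exactly one such representation).
record Domino : Set where
  constructor domino
  field
    base : Cube
    dax  : Axis
open Domino public

cubes : Domino → List Cube
cubes d = base d ∷ (base d ⊕ e (dax d)) ∷ []

-- v(d) = centre of black cube − centre of white cube
-- (= difference of the corresponding lower corners).
v : Domino → ℤ³
v d = if isBlack (base d) then neg³ (e (dax d)) else e (dax d)

Region : Set₁
Region = Cube → Set

cubesOf : List Domino → List Cube
cubesOf t = concatMap cubes t

-- t is a tiling of R: the dominoes have pairwise disjoint interiors
-- (no basic cube is used twice) and their union is R.
Tiling : Region → List Domino → Set
Tiling R t = Unique (cubesOf t) × (∀ c → (c ∈ cubesOf t → R c) × (R c → c ∈ cubesOf t))

-- Unit squares in a basic plane with normal w are represented by their
-- lower corner p ∈ ℤ³ (the square is p + [0,1]e_i + [0,1]e_j, i,j ≠ w).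

Adj : Axis → ℤ³ → ℤ³ → Set
Adj w a b = Σ Dir λ s → (Dir.axis s ≢ w) × (b ≡ a ⊕ vec s)

data Path (w : Axis) (P : ℤ³ → Set) : ℤ³ → ℤ³ → Set where
  here : ∀ {a} → P a → Path w P a a
  step : ∀ {a b c} → P a → Adj w a b → Path w P b c → Path w P a c

ConnectedInterior : Axis → List ℤ³ → Set
ConnectedInterior w D = ∀ {a b} → a ∈ D → b ∈ D → Path w (_∈ D) a b

-- D is simply connected (given connected interior): no holes, i.e. the
-- unit squares of the plane not in D are all edge-connected to each other.
SimplyConnected : Axis → ℤ → List ℤ³ → Set
SimplyConnected w k D =
  ∀ a b → coord w a ≡ k → coord w b ≡ k → a ∉ D → b ∉ D → Path w (_∉ D) a b

Cylinder : Axis → List ℤ³ → ℕ → Region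
Cylinder w D N c = Σ ℤ³ λ p → Σ ℕ λ j → p ∈ D × j < N × c ≡ p ⊕ ((+ j) · e w)

Column : Axis → ℤ³ → ℕ → Region
Column w q N c = Σ ℕ λ j → j < N × c ≡ q ⊕ ((+ j) · e w)

-- basic cubes of S^u(X) = int((X + [0,∞)u) \ X) for X a union of basic cubes
InS : Dir → Region → Region
InS u X c = ¬ X c × Σ ℤ³ λ c' → Σ ℕ λ m → X c' × c ≡ c' ⊕ ((+ suc m) · vec u)

Meets : Dir → Region → Domino → Set
Meets u X d = Any (InS u X) (cubes d)

-- SumOver P f t s : "s = Σ_{d ∈ t, P d} f d"  (a functional relation,
-- since P d and ¬ P d exclude each other).

data SumOver (P : Domino → Set) (f : Domino → ℤ) : List Domino → ℤ → Set where
  nil  : SumOver P f [] 0ℤ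
  yes  : ∀ {d t s} → P d → SumOver P f t s → SumOver P f (d ∷ t) (f d + s)
  no   : ∀ {d t s} → ¬ P d → SumOver P f t s → SumOver P f (d ∷ t) s

-- For u = ±w the region S^u(Q + [0,N]w) contains no cube of the cylinder, because Q ⊄ D.
-- Otherwise let a be the third axis and, for a square r of the plane outside D, let S(r) be
-- the sum of det(v(d), w, u) over the dominoes meeting the shadow S^u of the column over r;
-- only dominoes parallel to a have nonzero weight. S(r) is unchanged when r moves to an
-- adjacent square outside D: a step along u changes the shadow only by the column over a
-- square outside D, which contains no cube, and a step along a changes S by det(e_a, w, u)
-- times the colour-weighted count of the cubes in the union of the two shadows, which is 0
-- since every column of the cylinder has even height. As D is simply connected, Q is joined
-- outside D to a square so far along u that its shadow misses the cylinder, whence S(Q) = 0.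
module Submission where

open import Defs hiding (yes; no)
open import Data.Bool using (Bool; true; false; not; T; _∧_; _∨_; if_then_else_)
open import Data.Bool.Properties using (not-involutive; ∨-comm; ∧-zeroʳ; T-∨)
open import Data.Empty using (⊥-elim)
open import Data.Integer as ℤ using (ℤ; +_; -[1+_]; -_; _+_; _-_; _*_; ∣_∣; 0ℤ; 1ℤ; -1ℤ)
import Data.Integer.Properties as ℤ
open import Data.Integer.Tactic.RingSolver using (solve-∀)
open import Data.List using (List; []; _∷_; _++_; map; concatMap)
open import Data.List.Membership.Propositional using (_∈_; _∉_)
open import Data.List.Membership.Propositional.Properties using (∈-map⁺; ∈-map⁻; ∈-concatMap⁺)
open import Data.List.Membership.Propositional.Properties.WithK using (unique∧set⇒bag)
open import Data.List.Relation.Binary.BagAndSetEquality using (∼bag⇒↭)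
open import Data.List.Relation.Binary.Permutation.Propositional as Perm using (_↭_)
open import Data.List.Relation.Unary.All as All using (All)
open import Data.List.Relation.Unary.Any as Any using (here; there)
open import Data.List.Relation.Unary.Unique.Propositional using (Unique)
import Data.List.Relation.Unary.Unique.Propositional.Properties as Unique
open import Data.Nat as ℕ using (ℕ; zero; suc; _<_; _%_; _≡ᵇ_)
import Data.Nat.Properties as ℕ
open import Data.Nat.Divisibility using (_∣_; divides)
open import Data.Product using (∃; _×_; _,_; proj₁; proj₂)
open import Data.Sum using (_⊎_; inj₁; inj₂)
open import Data.Unit using (tt)
open import Function using (_⇔_; Equivalence; mk⇔)
open import Relation.Binary.PropositionalEquality
open import Relation.Nullary using (¬_; Dec; yes; no)

private
  variable
    A : Set

∑ : (A → ℤ) → List A → ℤ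
∑ f []       = 0ℤ
∑ f (x ∷ xs) = f x + ∑ f xs

∑-++ : (f : A → ℤ) (xs ys : List A) → ∑ f (xs ++ ys) ≡ ∑ f xs + ∑ f ys
∑-++ f []       ys = sym (ℤ.+-identityˡ _)
∑-++ f (x ∷ xs) ys = trans (cong (λ s → f x + s) (∑-++ f xs ys)) (sym (ℤ.+-assoc (f x) _ _))

∑-map : {B : Set} (f : B → ℤ) (g : A → B) (xs : List A) → ∑ f (map g xs) ≡ ∑ (λ x → f (g x)) xs
∑-map f g []       = refl
∑-map f g (x ∷ xs) = cong (λ s → f (g x) + s) (∑-map f g xs)

∑-concatMap : {B : Set} (f : B → ℤ) (g : A → List B) (xs : List A) →
              ∑ f (concatMap g xs) ≡ ∑ (λ x → ∑ f (g x)) xs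
∑-concatMap f g []       = refl
∑-concatMap f g (x ∷ xs) = trans (∑-++ f (g x) (concatMap g xs)) (cong (λ s → ∑ f (g x) + s) (∑-concatMap f g xs))

∑-cong : {f g : A → ℤ} (xs : List A) → (∀ {x} → x ∈ xs → f x ≡ g x) → ∑ f xs ≡ ∑ g xs
∑-cong []       eq = refl
∑-cong (x ∷ xs) eq = cong₂ _+_ (eq (here refl)) (∑-cong xs (λ x∈ → eq (there x∈)))

∑-+ : (f g : A → ℤ) (xs : List A) → ∑ (λ x → f x + g x) xs ≡ ∑ f xs + ∑ g xs
∑-+ f g []       = refl
∑-+ f g (x ∷ xs) = trans (cong (λ s → f x + g x + s) (∑-+ f g xs)) (lemma (f x) (g x) (∑ f xs) (∑ g xs))
  where
  lemma : ∀ a b c d → a + b + (c + d) ≡ a + c + (b + d)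
  lemma = solve-∀

∑-*ˡ : (s : ℤ) (f : A → ℤ) (xs : List A) → ∑ (λ x → s * f x) xs ≡ s * ∑ f xs
∑-*ˡ s f []       = sym (ℤ.*-zeroʳ s)
∑-*ˡ s f (x ∷ xs) = trans (cong (λ t → s * f x + t) (∑-*ˡ s f xs)) (sym (ℤ.*-distribˡ-+ s (f x) _))

∑-neg : (f : A → ℤ) (xs : List A) → ∑ (λ x → - f x) xs ≡ - ∑ f xs
∑-neg f []       = refl
∑-neg f (x ∷ xs) = trans (cong (λ s → - f x + s) (∑-neg f xs)) (sym (ℤ.neg-distrib-+ (f x) _))

∑-↭ : (f : A → ℤ) {xs ys : List A} → xs ↭ ys → ∑ f xs ≡ ∑ f ys
∑-↭ f Perm.refl          = refl
∑-↭ f (Perm.prep x p)    = cong (λ s → f x + s) (∑-↭ f p)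
∑-↭ f (Perm.swap x y p)  = trans (cong (λ s → f x + (f y + s)) (∑-↭ f p)) (lemma (f x) (f y) _)
  where
  lemma : ∀ a b c → a + (b + c) ≡ b + (a + c)
  lemma = solve-∀
∑-↭ f (Perm.trans p q)   = trans (∑-↭ f p) (∑-↭ f q)

x≡-x⇒x≡0 : ∀ {x : ℤ} → x ≡ - x → x ≡ 0ℤ
x≡-x⇒x≡0 {+ zero}   _  = refl
x≡-x⇒x≡0 {+ suc n}  ()
x≡-x⇒x≡0 { -[1+ n ]} ()

∑-sign-reversing-involution : {xs : List A} (ι : A → A) (f : A → ℤ) → Unique xs →
  (∀ x → ι (ι x) ≡ x) → (∀ {x} → x ∈ xs → ι x ∈ xs) → (∀ x → f (ι x) ≡ - f x) → ∑ f xs ≡ 0ℤ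
∑-sign-reversing-involution {xs = xs} ι f unique involutive closed reverses = x≡-x⇒x≡0 (begin
    ∑ f xs               ≡⟨ ∑-↭ f map-ι-↭ ⟨
    ∑ f (map ι xs)       ≡⟨ ∑-map f ι xs ⟩
    ∑ (λ x → f (ι x)) xs ≡⟨ ∑-cong xs (λ {x} _ → reverses x) ⟩
    ∑ (λ x → - f x) xs   ≡⟨ ∑-neg f xs ⟩
    - ∑ f xs             ∎)
  where
  open ≡-Reasoning
  ι-injective : ∀ {x y} → ι x ≡ ι y → x ≡ y
  ι-injective {x} {y} eq = trans (sym (involutive x)) (trans (cong ι eq) (involutive y))
  preimage : ∀ {y} → ∃ (λ x → x ∈ xs × y ≡ ι x) → y ∈ xs
  preimage (x , x∈ , refl) = closed x∈
  map-ι-↭ : map ι xs ↭ xs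
  map-ι-↭ = ∼bag⇒↭ (unique∧set⇒bag (Unique.map⁺ ι-injective unique) unique (λ {y} → mk⇔
    (λ y∈ → preimage (∈-map⁻ ι y∈))
    (λ y∈ → subst (_∈ map ι xs) (involutive y) (∈-map⁺ ι (closed y∈)))))

𝟙 : Bool → ℤ
𝟙 true  = 1ℤ
𝟙 false = 0ℤ

SumOver-𝟙 : {P : Domino → Set} {f : Domino → ℤ} (b : Domino → Bool) (ts : List Domino) →
  (∀ {d} → d ∈ ts → P d ⇔ T (b d)) → SumOver P f ts (∑ (λ d → 𝟙 (b d) * f d) ts)
SumOver-𝟙 b []       P⇔b = nil
SumOver-𝟙 {P} {f} b (d ∷ ts) P⇔b = cons (b d) (P⇔b (here refl)) (SumOver-𝟙 b ts (λ d∈ → P⇔b (there d∈)))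
  where
  cons : ∀ {s} bd → P d ⇔ T bd → SumOver P f ts s → SumOver P f (d ∷ ts) (𝟙 bd * f d + s)
  cons true  P⇔T rest = subst (SumOver P f (d ∷ ts)) (cong (_+ _) (sym (ℤ.*-identityˡ (f d))))
                          (SumOver.yes (Equivalence.from P⇔T tt) rest)
  cons false P⇔T rest = subst (SumOver P f (d ∷ ts)) (sym (ℤ.+-identityˡ _))
                          (SumOver.no (Equivalence.to P⇔T) rest)

SumOver-none : {P : Domino → Set} {f : Domino → ℤ} (ts : List Domino) →
  (∀ {d} → d ∈ ts → ¬ P d) → SumOver P f ts 0ℤ
SumOver-none []       ¬P = nil
SumOver-none (d ∷ ts) ¬P = SumOver.no (¬P (here refl)) (SumOver-none ts (λ d∈ → ¬P (there d∈)))

_≟ₐ_ : (i j : Axis) → Dec (i ≡ j)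
ax ≟ₐ ax = yes refl
ax ≟ₐ ay = no λ ()
ax ≟ₐ az = no λ ()
ay ≟ₐ ax = no λ ()
ay ≟ₐ ay = yes refl
ay ≟ₐ az = no λ ()
az ≟ₐ ax = no λ ()
az ≟ₐ ay = no λ ()
az ≟ₐ az = yes refl

coord-⊕ : ∀ i p q → coord i (p ⊕ q) ≡ coord i p + coord i q
coord-⊕ ax p q = refl
coord-⊕ ay p q = refl
coord-⊕ az p q = refl

coord-· : ∀ i m p → coord i (m · p) ≡ m * coord i p
coord-· ax m p = refl
coord-· ay m p = refl
coord-· az m p = refl

coord-e-same : ∀ i → coord i (e i) ≡ 1ℤ
coord-e-same ax = refl
coord-e-same ay = refl
coord-e-same az = refl

coord-e-other : ∀ {i j} → i ≢ j → coord i (e j) ≡ 0ℤ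
coord-e-other {ax} {ax} i≢j = ⊥-elim (i≢j refl)
coord-e-other {ax} {ay} i≢j = refl
coord-e-other {ax} {az} i≢j = refl
coord-e-other {ay} {ax} i≢j = refl
coord-e-other {ay} {ay} i≢j = ⊥-elim (i≢j refl)
coord-e-other {ay} {az} i≢j = refl
coord-e-other {az} {ax} i≢j = refl
coord-e-other {az} {ay} i≢j = refl
coord-e-other {az} {az} i≢j = ⊥-elim (i≢j refl)

ℤ³-ext : ∀ {p q} → (∀ i → coord i p ≡ coord i q) → p ≡ q
ℤ³-ext {⟨ _ , _ , _ ⟩} {⟨ _ , _ , _ ⟩} eq = cong₂ (λ a (bc : ℤ × ℤ) → ⟨ a , proj₁ bc , proj₂ bc ⟩)
  (eq ax) (cong₂ _,_ (eq ay) (eq az))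

coord-⊕· : ∀ i p m q → coord i (p ⊕ (m · q)) ≡ coord i p + m * coord i q
coord-⊕· i p m q = trans (coord-⊕ i p (m · q)) (cong (λ t → coord i p + t) (coord-· i m q))

coord-⊕e-same : ∀ i p → coord i (p ⊕ e i) ≡ coord i p + 1ℤ
coord-⊕e-same i p = trans (coord-⊕ i p (e i)) (cong (λ t → coord i p + t) (coord-e-same i))

coord-⊕e-other : ∀ {i j} p → i ≢ j → coord i (p ⊕ e j) ≡ coord i p
coord-⊕e-other {i} {j} p i≢j =
  trans (coord-⊕ i p (e j)) (trans (cong (λ t → coord i p + t) (coord-e-other i≢j)) (ℤ.+-identityʳ _))

coord-⊕·-orthogonal : ∀ i {q} p m → coord i q ≡ 0ℤ → coord i (p ⊕ (m · q)) ≡ coord i p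
coord-⊕·-orthogonal i {q} p m q⊥i = begin
  coord i (p ⊕ (m · q))     ≡⟨ coord-⊕· i p m q ⟩
  coord i p + m * coord i q ≡⟨ cong (λ t → coord i p + m * t) q⊥i ⟩
  coord i p + m * 0ℤ        ≡⟨ cong (λ t → coord i p + t) (ℤ.*-zeroʳ m) ⟩
  coord i p + 0ℤ            ≡⟨ ℤ.+-identityʳ _ ⟩
  coord i p                 ∎
  where open ≡-Reasoning

coord-⊕·e-same : ∀ i p m → coord i (p ⊕ (m · e i)) ≡ coord i p + m
coord-⊕·e-same i p m = trans (coord-⊕· i p m (e i))
  (trans (cong (λ t → coord i p + m * t) (coord-e-same i)) (cong (λ t → coord i p + t) (ℤ.*-identityʳ m)))

⊖e⊕e : ∀ c i → (c ⊕ neg³ (e i)) ⊕ e i ≡ c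
⊖e⊕e c i = ℤ³-ext λ j → begin
  coord j ((c ⊕ neg³ (e i)) ⊕ e i)                ≡⟨ coord-⊕ j (c ⊕ neg³ (e i)) (e i) ⟩
  coord j (c ⊕ neg³ (e i)) + coord j (e i)       ≡⟨ cong (_+ coord j (e i)) (coord-⊕· j c -1ℤ (e i)) ⟩
  coord j c + -1ℤ * coord j (e i) + coord j (e i) ≡⟨ cancel (coord j c) (coord j (e i)) ⟩
  coord j c                                       ∎
  where
  open ≡-Reasoning
  cancel : ∀ a b → a + -1ℤ * b + b ≡ a
  cancel = solve-∀

⊕e⊖e : ∀ c i → (c ⊕ e i) ⊕ neg³ (e i) ≡ c
⊕e⊖e c i = ℤ³-ext λ j → begin
  coord j ((c ⊕ e i) ⊕ neg³ (e i))                ≡⟨ coord-⊕· j (c ⊕ e i) -1ℤ (e i) ⟩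
  coord j (c ⊕ e i) + -1ℤ * coord j (e i)        ≡⟨ cong (_+ -1ℤ * coord j (e i)) (coord-⊕ j c (e i)) ⟩
  coord j c + coord j (e i) + -1ℤ * coord j (e i) ≡⟨ cancel (coord j c) (coord j (e i)) ⟩
  coord j c                                       ∎
  where
  open ≡-Reasoning
  cancel : ∀ a b → a + b + -1ℤ * b ≡ a
  cancel = solve-∀

odd : ℕ → Bool
odd zero    = false
odd (suc n) = not (odd n)

odd≡%2≡ᵇ1 : ∀ n → (n % 2 ≡ᵇ 1) ≡ odd n
odd≡%2≡ᵇ1 zero          = refl
odd≡%2≡ᵇ1 (suc zero)    = refl
odd≡%2≡ᵇ1 (suc (suc n)) = trans (odd≡%2≡ᵇ1 n) (sym (not-involutive (odd n)))

odd-∣i+1∣ : ∀ i → odd ∣ i + 1ℤ ∣ ≡ not (odd ∣ i ∣)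
odd-∣i+1∣ (+ n)            = cong odd (ℕ.+-comm n 1)
odd-∣i+1∣ -[1+ zero ]      = refl
odd-∣i+1∣ -[1+ suc n ]     = sym (not-involutive _)

even⇒¬odd : ∀ {n} → 2 ∣ n → odd n ≡ false
even⇒¬odd (divides q refl) = odd-2* q
  where
  odd-2* : ∀ q → odd (q ℕ.* 2) ≡ false
  odd-2* zero    = refl
  odd-2* (suc q) = cong (λ b → not (not b)) (odd-2* q)

colour : Cube → ℤ
colour c = if isBlack c then 1ℤ else -1ℤ

isBlack-⊕e : ∀ c i → isBlack (c ⊕ e i) ≡ not (isBlack c)
isBlack-⊕e c i = begin
  isBlack (c ⊕ e i)             ≡⟨ odd≡%2≡ᵇ1 ∣ Σc (c ⊕ e i) ∣ ⟩
  odd ∣ Σc (c ⊕ e i) ∣          ≡⟨ cong (λ s → odd ∣ s ∣) (Σc-⊕e i) ⟩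
  odd ∣ Σc c + 1ℤ ∣             ≡⟨ odd-∣i+1∣ (Σc c) ⟩
  not (odd ∣ Σc c ∣)            ≡⟨ cong not (odd≡%2≡ᵇ1 ∣ Σc c ∣) ⟨
  not (isBlack c)               ∎
  where
  open ≡-Reasoning
  Σc : Cube → ℤ
  Σc c = x c + y c + z c
  Σc-⊕e : ∀ i → Σc (c ⊕ e i) ≡ Σc c + 1ℤ
  Σc-⊕e ax = lemma (x c) (y c) (z c)
    where lemma : ∀ a b d → a + 1ℤ + (b + 0ℤ) + (d + 0ℤ) ≡ a + b + d + 1ℤ
          lemma = solve-∀
  Σc-⊕e ay = lemma (x c) (y c) (z c)
    where lemma : ∀ a b d → a + 0ℤ + (b + 1ℤ) + (d + 0ℤ) ≡ a + b + d + 1ℤ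
          lemma = solve-∀
  Σc-⊕e az = lemma (x c) (y c) (z c)
    where lemma : ∀ a b d → a + 0ℤ + (b + 0ℤ) + (d + 1ℤ) ≡ a + b + d + 1ℤ
          lemma = solve-∀

colour-⊕e : ∀ c i → colour (c ⊕ e i) ≡ - colour c
colour-⊕e c i rewrite isBlack-⊕e c i with isBlack c
... | true  = refl
... | false = refl

colour-⊖e : ∀ c i → colour (c ⊕ neg³ (e i)) ≡ - colour c
colour-⊖e c i = begin
  colour c′               ≡⟨ ℤ.neg-involutive _ ⟨
  - - colour c′           ≡⟨ cong -_ (colour-⊕e c′ i) ⟨
  - colour (c′ ⊕ e i)     ≡⟨ cong (λ d → - colour d) (⊖e⊕e c i) ⟩
  - colour c              ∎
  where
  open ≡-Reasoning
  c′ = c ⊕ neg³ (e i)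

det-neg₁ : ∀ p q r → det (neg³ p) q r ≡ - det p q r
det-neg₁ ⟨ a , b , c ⟩ ⟨ d , e , f ⟩ ⟨ g , h , i ⟩ = lemma a b c d e f g h i
  where
  lemma : ∀ a b c d e f g h i →
    (-1ℤ * a) * (e * i - f * h) + (-1ℤ * b) * (f * g - d * i) + (-1ℤ * c) * (d * h - e * g)
      ≡ - (a * (e * i - f * h) + b * (f * g - d * i) + c * (d * h - e * g))
  lemma = solve-∀

det-·₃ : ∀ p q m r → det p q (m · r) ≡ m * det p q r
det-·₃ ⟨ a , b , c ⟩ ⟨ d , e , f ⟩ m ⟨ g , h , i ⟩ = lemma a b c d e f m g h i
  where
  lemma : ∀ a b c d e f m g h i →
    a * (e * (m * i) - f * (m * h)) + b * (f * (m * g) - d * (m * i)) + c * (d * (m * h) - e * (m * g))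
      ≡ m * (a * (e * i - f * h) + b * (f * g - d * i) + c * (d * h - e * g))
  lemma = solve-∀

det-repeat₁₂ : ∀ p r → det p p r ≡ 0ℤ
det-repeat₁₂ ⟨ a , b , c ⟩ ⟨ g , h , i ⟩ = lemma a b c g h i
  where
  lemma : ∀ a b c g h i → a * (b * i - c * h) + b * (c * g - a * i) + c * (a * h - b * g) ≡ 0ℤ
  lemma = solve-∀

det-repeat₁₃ : ∀ p q → det p q p ≡ 0ℤ
det-repeat₁₃ ⟨ a , b , c ⟩ ⟨ d , e , f ⟩ = lemma a b c d e f
  where
  lemma : ∀ a b c d e f → a * (e * c - f * b) + b * (f * a - d * c) + c * (d * b - e * a) ≡ 0ℤ
  lemma = solve-∀

det-v : ∀ d q r → det (v d) q r ≡ - colour (base d) * det (e (dax d)) q r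
det-v d q r with isBlack (base d)
... | true  = trans (det-neg₁ (e (dax d)) q r) (sym (ℤ.-1*i≡-i _))
... | false = sym (ℤ.*-identityˡ _)

sgn : Sign → ℤ
sgn pos = 1ℤ
sgn neg = -1ℤ

sgn*sgn : ∀ s → sgn s * sgn s ≡ 1ℤ
sgn*sgn pos = refl
sgn*sgn neg = refl

vec≡sgn·e : ∀ i s → vec (dir i s) ≡ sgn s · e i
vec≡sgn·e ax pos = refl
vec≡sgn·e ay pos = refl
vec≡sgn·e az pos = refl
vec≡sgn·e i  neg = refl

coord-vec-⊥ : ∀ {l j} sn → l ≢ j → coord l (vec (dir j sn)) ≡ 0ℤ
coord-vec-⊥ {l} {j} sn l≢j = begin
  coord l (vec (dir j sn))     ≡⟨ cong (coord l) (vec≡sgn·e j sn) ⟩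
  coord l (sgn sn · e j)       ≡⟨ coord-· l (sgn sn) (e j) ⟩
  sgn sn * coord l (e j)       ≡⟨ cong (sgn sn *_) (coord-e-other l≢j) ⟩
  sgn sn * 0ℤ                  ≡⟨ ℤ.*-zeroʳ (sgn sn) ⟩
  0ℤ                           ∎
  where open ≡-Reasoning

coord-vec-same : ∀ j sn → coord j (vec (dir j sn)) ≡ sgn sn
coord-vec-same j sn = begin
  coord j (vec (dir j sn))     ≡⟨ cong (coord j) (vec≡sgn·e j sn) ⟩
  coord j (sgn sn · e j)       ≡⟨ coord-· j (sgn sn) (e j) ⟩
  sgn sn * coord j (e j)       ≡⟨ cong (sgn sn *_) (coord-e-same j) ⟩
  sgn sn * 1ℤ                  ≡⟨ ℤ.*-identityʳ (sgn sn) ⟩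
  sgn sn                       ∎
  where open ≡-Reasoning

record Frame (w i : Axis) : Set where
  field
    third   : Axis
    i≢w     : i ≢ w
    third≢w : third ≢ w
    third≢i : third ≢ i
    cover   : ∀ j → j ≡ w ⊎ j ≡ i ⊎ j ≡ third

frame : ∀ {w i} → i ≢ w → Frame w i
frame {ax} {ax} i≢w = ⊥-elim (i≢w refl)
frame {ax} {ay} i≢w = record { third = az ; i≢w = i≢w ; third≢w = λ () ; third≢i = λ ()
  ; cover = λ { ax → inj₁ refl ; ay → inj₂ (inj₁ refl) ; az → inj₂ (inj₂ refl) } }
frame {ax} {az} i≢w = record { third = ay ; i≢w = i≢w ; third≢w = λ () ; third≢i = λ ()
  ; cover = λ { ax → inj₁ refl ; az → inj₂ (inj₁ refl) ; ay → inj₂ (inj₂ refl) } }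
frame {ay} {ax} i≢w = record { third = az ; i≢w = i≢w ; third≢w = λ () ; third≢i = λ ()
  ; cover = λ { ay → inj₁ refl ; ax → inj₂ (inj₁ refl) ; az → inj₂ (inj₂ refl) } }
frame {ay} {ay} i≢w = ⊥-elim (i≢w refl)
frame {ay} {az} i≢w = record { third = ax ; i≢w = i≢w ; third≢w = λ () ; third≢i = λ ()
  ; cover = λ { ay → inj₁ refl ; az → inj₂ (inj₁ refl) ; ax → inj₂ (inj₂ refl) } }
frame {az} {ax} i≢w = record { third = ay ; i≢w = i≢w ; third≢w = λ () ; third≢i = λ ()
  ; cover = λ { az → inj₁ refl ; ax → inj₂ (inj₁ refl) ; ay → inj₂ (inj₂ refl) } }
frame {az} {ay} i≢w = record { third = ax ; i≢w = i≢w ; third≢w = λ () ; third≢i = λ ()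
  ; cover = λ { az → inj₁ refl ; ay → inj₂ (inj₁ refl) ; ax → inj₂ (inj₂ refl) } }
frame {az} {az} i≢w = ⊥-elim (i≢w refl)

top : Domino → Cube
top d = base d ⊕ e (dax d)

base∈cubesOf : ∀ {d t} → d ∈ t → base d ∈ cubesOf t
base∈cubesOf d∈t = ∈-concatMap⁺ cubes (Any.map (λ { refl → here refl }) d∈t)

top∈cubesOf : ∀ {d t} → d ∈ t → top d ∈ cubesOf t
top∈cubesOf d∈t = ∈-concatMap⁺ cubes (Any.map (λ { refl → there (here refl) }) d∈t)

layer-suc : ∀ w p j → (p ⊕ ((+ j) · e w)) ⊕ e w ≡ p ⊕ ((+ suc j) · e w)
layer-suc w p j = ℤ³-ext λ i → begin
  coord i ((p ⊕ ((+ j) · e w)) ⊕ e w)              ≡⟨ coord-⊕ i _ (e w) ⟩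
  coord i (p ⊕ ((+ j) · e w)) + coord i (e w)      ≡⟨ cong (_+ coord i (e w)) (coord-⊕· i p (+ j) (e w)) ⟩
  coord i p + (+ j) * coord i (e w) + coord i (e w) ≡⟨ lemma (coord i p) (+ j) (coord i (e w)) ⟩
  coord i p + (1ℤ + + j) * coord i (e w)           ≡⟨ coord-⊕· i p (+ suc j) (e w) ⟨
  coord i (p ⊕ ((+ suc j) · e w))                  ∎
  where
  open ≡-Reasoning
  lemma : ∀ a m b → a + m * b + b ≡ a + (1ℤ + m) * b
  lemma = solve-∀

module CylinderTiling {w : Axis} {k : ℤ} {D : List ℤ³} {N : ℕ} {t : List Domino}
  (onPlane : All (λ p → coord w p ≡ k) D) (tiling : Tiling (Cylinder w D N) t) where

  ∈⇒cylinder : ∀ {c} → c ∈ cubesOf t → Cylinder w D N c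
  ∈⇒cylinder {c} = proj₁ (proj₂ tiling c)

  cylinder⇒∈ : ∀ {c} → Cylinder w D N c → c ∈ cubesOf t
  cylinder⇒∈ {c} = proj₂ (proj₂ tiling c)

  height : Cube → ℤ
  height c = coord w c - k

  height-layer : ∀ {p} j → p ∈ D → height (p ⊕ ((+ j) · e w)) ≡ + j
  height-layer {p} j p∈D = begin
    coord w (p ⊕ ((+ j) · e w)) - k ≡⟨ cong (_- k) (coord-⊕·e-same w p (+ j)) ⟩
    coord w p + + j - k           ≡⟨ cong (λ h → h + + j - k) (All.lookup onPlane p∈D) ⟩
    k + + j - k                   ≡⟨ lemma k (+ j) ⟩
    + j                           ∎
    where
    open ≡-Reasoning
    lemma : ∀ k j → k + j - k ≡ j
    lemma = solve-∀

  odd-height-⊕e : ∀ c → odd ∣ height (c ⊕ e w) ∣ ≡ not (odd ∣ height c ∣)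
  odd-height-⊕e c = trans (cong (λ h → odd ∣ h - k ∣) (coord-⊕e-same w c))
    (trans (cong (λ h → odd ∣ h ∣) (lemma (coord w c) k)) (odd-∣i+1∣ (height c)))
    where
    lemma : ∀ a k → a + 1ℤ - k ≡ a - k + 1ℤ
    lemma = solve-∀

  -- Pairs the layers 2m and 2m + 1 of every column; as N is even it is a colour-reversing
  -- involution of the cylinder.
  flip : Cube → Cube
  flip c = if odd ∣ height c ∣ then c ⊕ neg³ (e w) else c ⊕ e w

  flip-even : ∀ {c} → odd ∣ height c ∣ ≡ false → flip c ≡ c ⊕ e w
  flip-even even rewrite even = refl

  flip-odd : ∀ {c} → odd ∣ height c ∣ ≡ true → flip c ≡ c ⊕ neg³ (e w)
  flip-odd odd′ rewrite odd′ = refl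

  flip-involutive : ∀ c → flip (flip c) ≡ c
  flip-involutive c with odd ∣ height c ∣ in parity
  ... | false = trans (flip-odd (trans (odd-height-⊕e c) (cong not parity))) (⊕e⊖e c w)
  ... | true  = trans (flip-even below) (⊖e⊕e c w)
    where
    below : odd ∣ height (c ⊕ neg³ (e w)) ∣ ≡ false
    below = begin
      odd ∣ height c′ ∣                ≡⟨ not-involutive _ ⟨
      not (not (odd ∣ height c′ ∣))    ≡⟨ cong not (odd-height-⊕e c′) ⟨
      not (odd ∣ height (c′ ⊕ e w) ∣)  ≡⟨ cong (λ d → not (odd ∣ height d ∣)) (⊖e⊕e c w) ⟩
      not (odd ∣ height c ∣)           ≡⟨ cong not parity ⟩
      false                            ∎
      where
      open ≡-Reasoning
      c′ = c ⊕ neg³ (e w)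

  colour-flip : ∀ c → colour (flip c) ≡ - colour c
  colour-flip c with odd ∣ height c ∣
  ... | false = colour-⊕e c w
  ... | true  = colour-⊖e c w

  flip-closed : odd N ≡ false → ∀ {c} → c ∈ cubesOf t → flip c ∈ cubesOf t
  flip-closed evenN c∈ with ∈⇒cylinder c∈
  ... | p , j , p∈D , j<N , refl with odd j in parity
  ... | false = cylinder⇒∈ (p , suc j , p∈D , 1+j<N ,
                 trans (flip-even (trans (cong (λ h → odd ∣ h ∣) (height-layer j p∈D)) parity)) (layer-suc w p j))
    where
    1+j<N : suc j < N
    1+j<N = ℕ.≤∧≢⇒< j<N λ 1+j≡N → true≢false (trans (sym (cong not parity)) (trans (cong odd 1+j≡N) evenN))
      where
      true≢false : true ≢ false
      true≢false ()
  ... | true with j | j<N | parity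
  ...   | suc j′ | 1+j′<N | parity′ = cylinder⇒∈ (p , j′ , p∈D , ℕ.<-trans (ℕ.n<1+n j′) 1+j′<N ,
          trans (flip-odd (trans (cong (λ h → odd ∣ h ∣) (height-layer (suc j′) p∈D)) parity′))
                (trans (cong (_⊕ neg³ (e w)) (sym (layer-suc w p j′))) (⊕e⊖e _ w)))

  balanced : odd N ≡ false → (φ : Cube → ℤ) → (∀ c → φ (c ⊕ e w) ≡ φ c) →
             ∑ (λ c → colour c * φ c) (cubesOf t) ≡ 0ℤ
  balanced evenN φ φ-⊕e = ∑-sign-reversing-involution flip (λ c → colour c * φ c) (proj₁ tiling)
    flip-involutive (flip-closed evenN) reverses
    where
    φ-⊖e : ∀ c → φ (c ⊕ neg³ (e w)) ≡ φ c
    φ-⊖e c = trans (sym (φ-⊕e _)) (cong φ (⊖e⊕e c w))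
    φ-flip : ∀ c → φ (flip c) ≡ φ c
    φ-flip c with odd ∣ height c ∣
    ... | false = φ-⊕e c
    ... | true  = φ-⊖e c
    reverses : ∀ c → colour (flip c) * φ (flip c) ≡ - (colour c * φ c)
    reverses c rewrite colour-flip c | φ-flip c = sym (ℤ.neg-distribˡ-* (colour c) (φ c))

  not-InS-vertical : ∀ {q c} sn → coord w q ≡ k → q ∉ D → c ∈ cubesOf t → ¬ InS (dir w sn) (Column w q N) c
  not-InS-vertical {q} sn q-on q∉D c∈ (_ , _ , m , (j , _ , refl) , c≡) with ∈⇒cylinder c∈
  ... | p , j′ , p∈D , _ , refl = q∉D (subst (_∈ D) (ℤ³-ext agree) p∈D)
    where
    agree : ∀ l → coord l p ≡ coord l q
    agree l with l ≟ₐ w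
    ... | yes refl = trans (All.lookup onPlane p∈D) (sym q-on)
    ... | no l≢w = begin
      coord l p                                                       ≡⟨ coord-⊕·-orthogonal l p (+ j′) (coord-e-other l≢w) ⟨
      coord l (p ⊕ ((+ j′) · e w))                                    ≡⟨ cong (coord l) c≡ ⟩
      coord l ((q ⊕ ((+ j) · e w)) ⊕ ((+ suc m) · vec (dir w sn)))    ≡⟨ coord-⊕·-orthogonal l _ (+ suc m) (coord-vec-⊥ sn l≢w) ⟩
      coord l (q ⊕ ((+ j) · e w))                                     ≡⟨ coord-⊕·-orthogonal l q (+ j) (coord-e-other l≢w) ⟩
      coord l q                                                       ∎
      where open ≡-Reasoning

  not-Meets-vertical : ∀ {q d} sn → coord w q ≡ k → q ∉ D → d ∈ t → ¬ Meets (dir w sn) (Column w q N) d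
  not-Meets-vertical sn q-on q∉D d∈ (here in-base)        = not-InS-vertical sn q-on q∉D (base∈cubesOf d∈) in-base
  not-Meets-vertical sn q-on q∉D d∈ (there (here in-top)) = not-InS-vertical sn q-on q∉D (top∈cubesOf d∈) in-top

upper-bound : ∀ {A : Set} (f : A → ℤ) (xs : List A) → ∃ λ B → ∀ {x} → x ∈ xs → f x ℤ.≤ B
upper-bound f []       = 0ℤ , λ ()
upper-bound f (x ∷ xs) with upper-bound f xs
... | B , bounded = f x ℤ.⊔ B , λ { (here refl) → ℤ.i≤i⊔j (f x) B ; (there x∈) → ℤ.≤-trans (bounded x∈) (ℤ.i≤j⊔i (f x) B) }

Path-source : ∀ {w P b c} → Path w P b c → P b
Path-source (here Pb)     = Pb
Path-source (step Pb _ _) = Pb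

isZero : ℤ → Bool
isZero (+ zero) = true
isZero _        = false

isPos : ℤ → Bool
isPos (+ suc _) = true
isPos _         = false

slide-identity : ∀ {W c c′ : ℤ} (x₋ x₀ x₊ x₀′ : Bool) (τ : ℤ) → W ≡ - c * τ → c′ ≡ - c → x₀′ ≡ x₀ →
  𝟙 (x₀ ∨ x₊) * W ≡ 𝟙 (x₋ ∨ x₀′) * W + τ * (c * 𝟙 (x₀ ∨ x₋) + (c′ * 𝟙 (x₊ ∨ x₀′) + 0ℤ))
slide-identity {c = c} x₋ x₀ x₊ _ τ refl refl refl rewrite ∨-comm x₀ x₋ | ∨-comm x₊ x₀ =
  lemma (𝟙 (x₀ ∨ x₊)) (𝟙 (x₋ ∨ x₀)) c τ
  where
  lemma : ∀ A B c τ → A * (- c * τ) ≡ B * (- c * τ) + τ * (c * B + (- c * A + 0ℤ))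
  lemma = solve-∀

parallel-identity : ∀ {W c c′ : ℤ} {z z′ : Bool} (m m′ : Bool) (τ : ℤ) → W ≡ 0ℤ → c′ ≡ - c → z′ ≡ z →
  𝟙 m * W ≡ 𝟙 m′ * W + τ * (c * 𝟙 z + (c′ * 𝟙 z′ + 0ℤ))
parallel-identity {c = c} {z = z} m m′ τ refl refl refl = lemma (𝟙 m) (𝟙 m′) (𝟙 z) c τ
  where
  lemma : ∀ A B Z c τ → A * 0ℤ ≡ B * 0ℤ + τ * (c * Z + (- c * Z + 0ℤ))
  lemma = solve-∀

isPos-≤0 : ∀ {x} → x ℤ.≤ 0ℤ → isPos x ≡ false
isPos-≤0 {+ zero}   _        = refl
isPos-≤0 {+ suc n}  (ℤ.+≤+ ())
isPos-≤0 { -[1+ n ]} _       = refl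

T-isZero∧isPos : ∀ x y → T (isZero x ∧ isPos y) → x ≡ 0ℤ × ∃ λ m → y ≡ + suc m
T-isZero∧isPos (+ zero) (+ suc m) _ = refl , m , refl

isZero-∧-cong : ∀ x {b b′} → (x ≡ 0ℤ → b ≡ b′) → isZero x ∧ b ≡ isZero x ∧ b′
isZero-∧-cong (+ zero)   b≡b′ = b≡b′ refl
isZero-∧-cong (+ suc n)  b≡b′ = refl
isZero-∧-cong -[1+ n ]   b≡b′ = refl

isPos-+sgn : ∀ x s → x ≢ 0ℤ → x + sgn s ≢ 0ℤ → isPos (x + sgn s) ≡ isPos x
isPos-+sgn (+ zero)          s   x≢0 _    = ⊥-elim (x≢0 refl)
isPos-+sgn (+ suc n)         pos _   _    = refl
isPos-+sgn (+ suc zero)      neg _   x′≢0 = ⊥-elim (x′≢0 refl)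
isPos-+sgn (+ suc (suc n))   neg _   _    = refl
isPos-+sgn -[1+ zero ]       pos _   x′≢0 = ⊥-elim (x′≢0 refl)
isPos-+sgn -[1+ suc n ]      pos _   _    = refl
isPos-+sgn -[1+ n ]          neg _   _    = refl

sgn*-cancel : ∀ s {x} → sgn s * x ≡ 0ℤ → x ≡ 0ℤ
sgn*-cancel pos {x} eq = trans (sym (ℤ.*-identityˡ x)) eq
sgn*-cancel neg {x} eq = trans (sym (ℤ.neg-involutive x)) (cong -_ (trans (sym (ℤ.-1*i≡-i x)) eq))

module Shadow {w i : Axis} (F : Frame w i) (s : Sign) {k : ℤ} {D : List ℤ³} {N : ℕ} {t : List Domino}
  (onPlane : All (λ p → coord w p ≡ k) D) (evenN : odd N ≡ false) (tiling : Tiling (Cylinder w D N) t) where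

  open Frame F renaming (third to a; third≢w to a≢w; third≢i to a≢i)
  open CylinderTiling {w = w} {N = N} {t = t} onPlane tiling

  u : Dir
  u = dir i s

  σ : ℤ
  σ = sgn s

  offset : ℤ³ → Cube → ℤ
  offset r c = coord a c - coord a r

  depth : ℤ³ → Cube → ℤ
  depth r c = σ * (coord i c - coord i r)

  -- Membership in S^u of the whole line of cubes over the square r; on cubes of the cylinder it
  -- agrees with InS u (Column w r N) (see inShadow⇒InS).
  inShadow : ℤ³ → Cube → Bool
  inShadow r c = isZero (offset r c) ∧ isPos (depth r c)

  meetsShadow : ℤ³ → Domino → Bool
  meetsShadow r d = inShadow r (base d) ∨ inShadow r (top d)

  weight : Domino → ℤ
  weight d = det (v d) (e w) (vec u)

  shadowSum : ℤ³ → ℤ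
  shadowSum r = ∑ (λ d → 𝟙 (meetsShadow r d) * weight d) t

  OutsideBase : ℤ³ → Set
  OutsideBase r = coord w r ≡ k × r ∉ D

  i≢a : i ≢ a
  i≢a i≡a = a≢i (sym i≡a)

  w≢i : w ≢ i
  w≢i w≡i = i≢w (sym w≡i)

  offset-⊕e-cube : ∀ {j} r c → j ≢ a → offset r (c ⊕ e j) ≡ offset r c
  offset-⊕e-cube r c j≢a = cong (_- coord a r) (coord-⊕e-other c (λ a≡j → j≢a (sym a≡j)))

  depth-⊕e-cube : ∀ {j} r c → j ≢ i → depth r (c ⊕ e j) ≡ depth r c
  depth-⊕e-cube r c j≢i = cong (λ x → σ * (x - coord i r)) (coord-⊕e-other c (λ i≡j → j≢i (sym i≡j)))

  offset-⊕e-ref : ∀ {j} r c → j ≢ a → offset (r ⊕ e j) c ≡ offset r c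
  offset-⊕e-ref r c j≢a = cong (λ x → coord a c - x) (coord-⊕e-other r (λ a≡j → j≢a (sym a≡j)))

  depth-⊕e-ref : ∀ {j} r c → j ≢ i → depth (r ⊕ e j) c ≡ depth r c
  depth-⊕e-ref r c j≢i = cong (λ x → σ * (coord i c - x)) (coord-⊕e-other r (λ i≡j → j≢i (sym i≡j)))

  offset-⊕a-cube : ∀ r c → offset r (c ⊕ e a) ≡ offset r c + 1ℤ
  offset-⊕a-cube r c = trans (cong (_- coord a r) (coord-⊕e-same a c)) (lemma (coord a c) (coord a r))
    where
    lemma : ∀ x y → x + 1ℤ - y ≡ x - y + 1ℤ
    lemma = solve-∀

  offset-⊕a-ref : ∀ r c → offset (r ⊕ e a) c ≡ offset r c - 1ℤ
  offset-⊕a-ref r c = trans (cong (λ x → coord a c - x) (coord-⊕e-same a r)) (lemma (coord a c) (coord a r))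
    where
    lemma : ∀ x y → x - (y + 1ℤ) ≡ x - y - 1ℤ
    lemma = solve-∀

  depth-⊕i-cube : ∀ r c → depth r (c ⊕ e i) ≡ depth r c + σ
  depth-⊕i-cube r c = trans (cong (λ x → σ * (x - coord i r)) (coord-⊕e-same i c)) (lemma σ (coord i c) (coord i r))
    where
    lemma : ∀ σ x y → σ * (x + 1ℤ - y) ≡ σ * (x - y) + σ
    lemma = solve-∀

  depth-⊕i-ref : ∀ r c → depth (r ⊕ e i) c ≡ depth r c - σ
  depth-⊕i-ref r c = trans (cong (λ x → σ * (coord i c - x)) (coord-⊕e-same i r)) (lemma σ (coord i c) (coord i r))
    where
    lemma : ∀ σ x y → σ * (x - (y + 1ℤ)) ≡ σ * (x - y) - σ
    lemma = solve-∀

  frame-ext : ∀ {p q} → coord w p ≡ coord w q → coord i p ≡ coord i q → coord a p ≡ coord a q → p ≡ q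
  frame-ext {p} {q} w≡ i≡ a≡ = ℤ³-ext λ j → by j (cover j)
    where
    by : ∀ j → j ≡ w ⊎ j ≡ i ⊎ j ≡ a → coord j p ≡ coord j q
    by _ (inj₁ refl)        = w≡
    by _ (inj₂ (inj₁ refl)) = i≡
    by _ (inj₂ (inj₂ refl)) = a≡

  cube-not-over : ∀ {r c} → OutsideBase r → c ∈ cubesOf t → offset r c ≡ 0ℤ → depth r c ≢ 0ℤ
  cube-not-over {r} (r-on , r∉D) c∈ offset≡0 depth≡0 with ∈⇒cylinder c∈
  ... | p , j , p∈D , _ , refl = r∉D (subst (_∈ D) p≡r p∈D)
    where
    below : ∀ {l} → l ≢ w → coord l (p ⊕ ((+ j) · e w)) ≡ coord l p
    below {l} l≢w = coord-⊕·-orthogonal l p (+ j) (coord-e-other l≢w)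
    p≡r : p ≡ r
    p≡r = frame-ext (trans (All.lookup onPlane p∈D) (sym r-on))
      (trans (sym (below i≢w)) (ℤ.i-j≡0⇒i≡j _ _ (sgn*-cancel s depth≡0)))
      (trans (sym (below a≢w)) (ℤ.i-j≡0⇒i≡j _ _ offset≡0))

  inShadow-⊕w : ∀ r c → inShadow r (c ⊕ e w) ≡ inShadow r c
  inShadow-⊕w r c = cong₂ (λ x y → isZero x ∧ isPos y)
    (offset-⊕e-cube r c (λ w≡a → a≢w (sym w≡a))) (depth-⊕e-cube r c w≢i)

  inShadow-⊕a-both : ∀ r c → inShadow (r ⊕ e a) (c ⊕ e a) ≡ inShadow r c
  inShadow-⊕a-both r c = cong₂ (λ x y → isZero x ∧ isPos y)
    (trans (offset-⊕a-ref r (c ⊕ e a)) (trans (cong (_- 1ℤ) (offset-⊕a-cube r c)) (lemma (offset r c))))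
    (trans (depth-⊕e-ref r (c ⊕ e a) a≢i) (depth-⊕e-cube r c a≢i))
    where
    lemma : ∀ x → x + 1ℤ - 1ℤ ≡ x
    lemma = solve-∀

  -- A shift of the depth by ±1 can change its positivity only through depth 0, i.e. inside the
  -- column over r or r′, which contains no cube of the cylinder.
  inShadow-cross : ∀ {r r′ c c′} → OutsideBase r → OutsideBase r′ → c ∈ cubesOf t → c′ ∈ cubesOf t →
    offset r′ c′ ≡ offset r c → depth r′ c′ ≡ depth r c + σ → inShadow r′ c′ ≡ inShadow r c
  inShadow-cross {r} {r′} {c} {c′} r-out r′-out c∈ c′∈ offset≡ depth≡ = begin
    isZero (offset r′ c′) ∧ isPos (depth r′ c′)   ≡⟨ cong₂ (λ x y → isZero x ∧ isPos y) offset≡ depth≡ ⟩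
    isZero (offset r c) ∧ isPos (depth r c + σ)   ≡⟨ isZero-∧-cong (offset r c) (λ offset≡0 →
                                                      isPos-+sgn (depth r c) s (cube-not-over r-out c∈ offset≡0)
                                                        (λ depth≡0 → cube-not-over r′-out c′∈ (trans offset≡ offset≡0) (trans depth≡ depth≡0))) ⟩
    isZero (offset r c) ∧ isPos (depth r c)       ∎
    where open ≡-Reasoning

  inShadow-⊕i-cube : ∀ {r c} → OutsideBase r → c ∈ cubesOf t → c ⊕ e i ∈ cubesOf t →
                     inShadow r (c ⊕ e i) ≡ inShadow r c
  inShadow-⊕i-cube {r} {c} r-out c∈ c′∈ =
    inShadow-cross r-out r-out c∈ c′∈ (offset-⊕e-cube r c i≢a) (depth-⊕i-cube r c)

  inShadow-⊕i-ref : ∀ {r c} → OutsideBase r → OutsideBase (r ⊕ e i) → c ∈ cubesOf t →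
                    inShadow (r ⊕ e i) c ≡ inShadow r c
  inShadow-⊕i-ref {r} {c} r-out r′-out c∈ = sym (inShadow-cross r′-out r-out c∈ c∈
    (sym (offset-⊕e-ref r c i≢a)) (trans (sym (cancel (depth r c) σ)) (cong (_+ σ) (sym (depth-⊕i-ref r c)))))
    where
    cancel : ∀ x σ → x - σ + σ ≡ x
    cancel = solve-∀

  τ : ℤ
  τ = det (e a) (e w) (vec u)

  weight-w : ∀ b → weight (domino b w) ≡ 0ℤ
  weight-w b = trans (det-v (domino b w) (e w) (vec u))
    (trans (cong (- colour b *_) (det-repeat₁₂ (e w) (vec u))) (ℤ.*-zeroʳ (- colour b)))

  weight-i : ∀ b → weight (domino b i) ≡ 0ℤ
  weight-i b = begin
    weight (domino b i)                       ≡⟨ det-v (domino b i) (e w) (vec u) ⟩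
    - colour b * det (e i) (e w) (vec u)      ≡⟨ cong (λ x → - colour b * det (e i) (e w) x) (vec≡sgn·e i s) ⟩
    - colour b * det (e i) (e w) (σ · e i)    ≡⟨ cong (- colour b *_) (det-·₃ (e i) (e w) σ (e i)) ⟩
    - colour b * (σ * det (e i) (e w) (e i))  ≡⟨ cong (λ x → - colour b * (σ * x)) (det-repeat₁₃ (e i) (e w)) ⟩
    - colour b * (σ * 0ℤ)                     ≡⟨ cong (- colour b *_) (ℤ.*-zeroʳ σ) ⟩
    - colour b * 0ℤ                           ≡⟨ ℤ.*-zeroʳ (- colour b) ⟩
    0ℤ                                        ∎
    where open ≡-Reasoning

  weight-a : ∀ b → weight (domino b a) ≡ - colour b * τ
  weight-a b = det-v (domino b a) (e w) (vec u)

  inTwoShadows : ℤ³ → Cube → Bool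
  inTwoShadows r c = inShadow r c ∨ inShadow (r ⊕ e a) c

  -- For dominoes parallel to w or u both sides vanish (zero weight, and two cubes of opposite
  -- colours on the same side of the union of the two shadows); for dominoes parallel to a it is
  -- a formal identity.
  meetsShadow-⊕a : ∀ {r d} → OutsideBase r → OutsideBase (r ⊕ e a) → d ∈ t →
    𝟙 (meetsShadow r d) * weight d
      ≡ 𝟙 (meetsShadow (r ⊕ e a) d) * weight d + τ * ∑ (λ c → colour c * 𝟙 (inTwoShadows r c)) (cubes d)
  meetsShadow-⊕a {r} {domino b j} r-out r′-out d∈ with cover j
  ... | inj₁ refl = parallel-identity (meetsShadow r (domino b w)) (meetsShadow (r ⊕ e a) (domino b w)) τ
        (weight-w b) (colour-⊕e b w) (cong₂ _∨_ (inShadow-⊕w r b) (inShadow-⊕w (r ⊕ e a) b))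
  ... | inj₂ (inj₁ refl) = parallel-identity (meetsShadow r (domino b i)) (meetsShadow (r ⊕ e a) (domino b i)) τ
        (weight-i b) (colour-⊕e b i)
        (cong₂ _∨_ (inShadow-⊕i-cube r-out (base∈cubesOf d∈) (top∈cubesOf d∈))
                   (inShadow-⊕i-cube r′-out (base∈cubesOf d∈) (top∈cubesOf d∈)))
  ... | inj₂ (inj₂ refl) = slide-identity (inShadow (r ⊕ e a) b) (inShadow r b) (inShadow r (b ⊕ e a))
        (inShadow (r ⊕ e a) (b ⊕ e a)) τ (weight-a b) (colour-⊕e b a) (inShadow-⊕a-both r b)

  shadowSum-⊕a : ∀ {r} → OutsideBase r → OutsideBase (r ⊕ e a) → shadowSum r ≡ shadowSum (r ⊕ e a)
  shadowSum-⊕a {r} r-out r′-out = begin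
    shadowSum r                                 ≡⟨ ∑-cong t (meetsShadow-⊕a r-out r′-out) ⟩
    ∑ (λ d → 𝟙 (meetsShadow r′ d) * weight d + τ * exits d) t
                                                ≡⟨ ∑-+ (λ d → 𝟙 (meetsShadow r′ d) * weight d) (λ d → τ * exits d) t ⟩
    shadowSum r′ + ∑ (λ d → τ * exits d) t      ≡⟨ cong (λ x → shadowSum r′ + x) (∑-*ˡ τ exits t) ⟩
    shadowSum r′ + τ * ∑ exits t                ≡⟨ cong (λ x → shadowSum r′ + τ * x) exits-vanish ⟩
    shadowSum r′ + τ * 0ℤ                       ≡⟨ cong (λ x → shadowSum r′ + x) (ℤ.*-zeroʳ τ) ⟩
    shadowSum r′ + 0ℤ                           ≡⟨ ℤ.+-identityʳ _ ⟩
    shadowSum r′                                ∎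
    where
    open ≡-Reasoning
    r′ = r ⊕ e a
    χ : Cube → ℤ
    χ c = colour c * 𝟙 (inTwoShadows r c)
    exits : Domino → ℤ
    exits d = ∑ χ (cubes d)
    exits-vanish : ∑ exits t ≡ 0ℤ
    exits-vanish = trans (sym (∑-concatMap χ cubes t))
      (balanced evenN (λ c → 𝟙 (inTwoShadows r c)) (λ c → cong₂ (λ x y → 𝟙 (x ∨ y)) (inShadow-⊕w r c) (inShadow-⊕w r′ c)))

  shadowSum-⊕i : ∀ {r} → OutsideBase r → OutsideBase (r ⊕ e i) → shadowSum r ≡ shadowSum (r ⊕ e i)
  shadowSum-⊕i r-out r′-out = ∑-cong t λ {d} d∈ → cong (λ m → 𝟙 m * weight d) (sym (cong₂ _∨_
    (inShadow-⊕i-ref r-out r′-out (base∈cubesOf d∈)) (inShadow-⊕i-ref r-out r′-out (top∈cubesOf d∈))))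

  reverse-step : ∀ {j} → (∀ {r} → OutsideBase r → OutsideBase (r ⊕ e j) → shadowSum r ≡ shadowSum (r ⊕ e j)) →
                 ∀ {r} → OutsideBase r → OutsideBase (r ⊕ neg³ (e j)) → shadowSum r ≡ shadowSum (r ⊕ neg³ (e j))
  reverse-step {j} forward {r} r-out r′-out =
    sym (trans (forward r′-out (subst OutsideBase (sym (⊖e⊕e r j)) r-out)) (cong shadowSum (⊖e⊕e r j)))

  shadowSum-step : ∀ {r} d′ → Dir.axis d′ ≢ w → OutsideBase r → OutsideBase (r ⊕ vec d′) →
                   shadowSum r ≡ shadowSum (r ⊕ vec d′)
  shadowSum-step (dir j sn) j≢w with cover j | sn
  ... | inj₁ refl        | _   = ⊥-elim (j≢w refl)
  ... | inj₂ (inj₁ refl) | pos = shadowSum-⊕i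
  ... | inj₂ (inj₁ refl) | neg = reverse-step {i} shadowSum-⊕i
  ... | inj₂ (inj₂ refl) | pos = shadowSum-⊕a
  ... | inj₂ (inj₂ refl) | neg = reverse-step {a} shadowSum-⊕a

  shadowSum-path : ∀ {r f} → Path w (_∉ D) r f → coord w r ≡ k → shadowSum r ≡ shadowSum f
  shadowSum-path (here _) _ = refl
  shadowSum-path {r} (step r∉D (dir j sn , j≢w , refl) rest) r-on =
    trans (shadowSum-step (dir j sn) j≢w (r-on , r∉D) (r′-on , Path-source rest)) (shadowSum-path rest r′-on)
    where
    r′-on : coord w (r ⊕ vec (dir j sn)) ≡ k
    r′-on = trans (coord-⊕ w r (vec (dir j sn)))
      (trans (cong (λ x → coord w r + x) (coord-vec-⊥ sn (λ w≡j → j≢w (sym w≡j)))) (trans (ℤ.+-identityʳ _) r-on))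

  coord-⊕·u-⊥ : ∀ {l} p m → l ≢ i → coord l (p ⊕ (m · vec u)) ≡ coord l p
  coord-⊕·u-⊥ {l} p m l≢i = coord-⊕·-orthogonal l p m (coord-vec-⊥ s l≢i)

  coord-⊕·w-⊥ : ∀ {l} p m → l ≢ w → coord l (p ⊕ (m · e w)) ≡ coord l p
  coord-⊕·w-⊥ {l} p m l≢w = coord-⊕·-orthogonal l p m (coord-e-other l≢w)

  depth-self : ∀ r → depth r r ≡ 0ℤ
  depth-self r = trans (cong (σ *_) (ℤ.+-inverseʳ (coord i r))) (ℤ.*-zeroʳ σ)

  depth-⊕·w : ∀ r c m → depth r (c ⊕ (m · e w)) ≡ depth r c
  depth-⊕·w r c m = cong (λ x → σ * (x - coord i r)) (coord-⊕·w-⊥ c m i≢w)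

  depth-⊕·u-cube : ∀ r c m → depth r (c ⊕ (m · vec u)) ≡ depth r c + m
  depth-⊕·u-cube r c m = begin
    σ * (coord i (c ⊕ (m · vec u)) - coord i r)   ≡⟨ cong (λ x → σ * (x - coord i r)) (coord-⊕· i c m (vec u)) ⟩
    σ * (coord i c + m * coord i (vec u) - coord i r) ≡⟨ cong (λ x → σ * (coord i c + m * x - coord i r)) (coord-vec-same i s) ⟩
    σ * (coord i c + m * σ - coord i r)           ≡⟨ lemma σ (coord i c) (coord i r) m ⟩
    depth r c + (σ * σ) * m                       ≡⟨ cong (λ x → depth r c + x * m) (sgn*sgn s) ⟩
    depth r c + 1ℤ * m                            ≡⟨ cong (λ x → depth r c + x) (ℤ.*-identityˡ m) ⟩
    depth r c + m                                 ∎
    where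
    open ≡-Reasoning
    lemma : ∀ σ x y m → σ * (x + m * σ - y) ≡ σ * (x - y) + (σ * σ) * m
    lemma = solve-∀

  depth-⊕·u-ref : ∀ r c m → depth (r ⊕ (m · vec u)) c ≡ depth r c - m
  depth-⊕·u-ref r c m = begin
    σ * (coord i c - coord i (r ⊕ (m · vec u)))   ≡⟨ cong (λ x → σ * (coord i c - x)) (coord-⊕· i r m (vec u)) ⟩
    σ * (coord i c - (coord i r + m * coord i (vec u))) ≡⟨ cong (λ x → σ * (coord i c - (coord i r + m * x))) (coord-vec-same i s) ⟩
    σ * (coord i c - (coord i r + m * σ))         ≡⟨ lemma σ (coord i c) (coord i r) m ⟩
    depth r c - (σ * σ) * m                       ≡⟨ cong (λ x → depth r c - x * m) (sgn*sgn s) ⟩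
    depth r c - 1ℤ * m                            ≡⟨ cong (λ x → depth r c - x) (ℤ.*-identityˡ m) ⟩
    depth r c - m                                 ∎
    where
    open ≡-Reasoning
    lemma : ∀ σ x y m → σ * (x - (y + m * σ)) ≡ σ * (x - y) - (σ * σ) * m
    lemma = solve-∀

  coord-i-from-depth : ∀ r c → coord i c ≡ σ * depth r c + coord i r
  coord-i-from-depth r c = begin
    coord i c                                 ≡⟨ lemma (coord i c) (coord i r) ⟩
    1ℤ * (coord i c - coord i r) + coord i r  ≡⟨ cong (λ x → x * (coord i c - coord i r) + coord i r) (sgn*sgn s) ⟨
    σ * σ * (coord i c - coord i r) + coord i r ≡⟨ cong (_+ coord i r) (ℤ.*-assoc σ σ _) ⟩
    σ * depth r c + coord i r                 ∎
    where
    open ≡-Reasoning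
    lemma : ∀ x y → x ≡ 1ℤ * (x - y) + y
    lemma = solve-∀

  coord-a-from-offset : ∀ r c → coord a c ≡ offset r c + coord a r
  coord-a-from-offset r c = lemma (coord a c) (coord a r)
    where
    lemma : ∀ x y → x ≡ x - y + y
    lemma = solve-∀

  shadowSum-vanishes : ∀ {f} → (∀ {c} → c ∈ cubesOf t → inShadow f c ≡ false) → shadowSum f ≡ 0ℤ
  shadowSum-vanishes outside = begin
    shadowSum _                 ≡⟨ ∑-cong t (λ {d} d∈ → cong (λ m → 𝟙 m * weight d)
                                     (cong₂ _∨_ (outside (base∈cubesOf d∈)) (outside (top∈cubesOf d∈)))) ⟩
    ∑ (λ d → 0ℤ * weight d) t   ≡⟨ ∑-*ˡ 0ℤ weight t ⟩
    0ℤ * ∑ weight t             ≡⟨ ℤ.*-zeroˡ (∑ weight t) ⟩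
    0ℤ                          ∎
    where open ≡-Reasoning

  far-square : ∀ {q} → coord w q ≡ k → ∃ λ f → OutsideBase f × shadowSum f ≡ 0ℤ
  far-square {q} q-on = f , (trans (coord-⊕·u-⊥ q M w≢i) q-on , f∉D) , shadowSum-vanishes outside
    where
    B : ℤ
    B = proj₁ (upper-bound (depth q) D)
    bounded : ∀ {p} → p ∈ D → depth q p ℤ.≤ B
    bounded = proj₂ (upper-bound (depth q) D)
    M : ℤ
    M = 1ℤ + B
    f : ℤ³
    f = q ⊕ (M · vec u)
    f∉D : f ∉ D
    f∉D f∈D = ℤ.<-irrefl refl (ℤ.suc[i]≤j⇒i<j (subst (ℤ._≤ B) depth-q-f (bounded f∈D)))
      where
      depth-q-f : depth q f ≡ M
      depth-q-f = trans (depth-⊕·u-cube q q M) (trans (cong (_+ M) (depth-self q)) (ℤ.+-identityˡ M))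
    outside : ∀ {c} → c ∈ cubesOf t → inShadow f c ≡ false
    outside c∈ with ∈⇒cylinder c∈
    ... | p , j , p∈D , _ , refl = trans (cong (isZero (offset f (p ⊕ ((+ j) · e w))) ∧_) (isPos-≤0 below)) (∧-zeroʳ _)
      where
      below : depth f (p ⊕ ((+ j) · e w)) ℤ.≤ 0ℤ
      below = subst (ℤ._≤ 0ℤ) (sym (trans (depth-⊕·u-ref q _ M) (cong (_- M) (depth-⊕·w q p (+ j)))))
        (ℤ.i≤j⇒i-j≤0 (ℤ.≤-trans (bounded p∈D) (ℤ.i≤suc[i] B)))

  shadowCube : ℤ³ → ℕ → ℕ → Cube
  shadowCube q j m = (q ⊕ ((+ j) · e w)) ⊕ ((+ suc m) · vec u)

  offset-shadowCube : ∀ q j m → offset q (shadowCube q j m) ≡ 0ℤ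
  offset-shadowCube q j m = trans (cong (_- coord a q) (trans (coord-⊕·u-⊥ _ (+ suc m) a≢i) (coord-⊕·w-⊥ q (+ j) a≢w)))
    (ℤ.+-inverseʳ (coord a q))

  depth-shadowCube : ∀ q j m → depth q (shadowCube q j m) ≡ + suc m
  depth-shadowCube q j m = trans (depth-⊕·u-cube q _ (+ suc m))
    (trans (cong (_+ + suc m) (trans (depth-⊕·w q q (+ j)) (depth-self q))) (ℤ.+-identityˡ _))

  InS⇒inShadow : ∀ {q c} → InS u (Column w q N) c → T (inShadow q c)
  InS⇒inShadow {q} (_ , _ , m , (j , _ , refl) , refl) =
    subst T (sym (cong₂ (λ x y → isZero x ∧ isPos y) (offset-shadowCube q j m) (depth-shadowCube q j m))) tt

  inShadow⇒InS : ∀ {q c} → coord w q ≡ k → c ∈ cubesOf t → T (inShadow q c) → InS u (Column w q N) c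
  inShadow⇒InS {q} {c} q-on c∈ shadow with T-isZero∧isPos (offset q c) (depth q c) shadow | ∈⇒cylinder c∈
  ... | offset≡0 , m , depth≡ | p , j , p∈D , j<N , refl =
    outside-column , q ⊕ ((+ j) · e w) , m , (j , j<N , refl) , frame-ext w≡ i≡ a≡
    where
    outside-column : ¬ Column w q N c
    outside-column (j′ , _ , c≡) with () ← trans (sym depth≡)
      (trans (cong (depth q) c≡) (trans (depth-⊕·w q q (+ j′)) (depth-self q)))
    w≡ : coord w c ≡ coord w (shadowCube q j m)
    w≡ = begin
      coord w (p ⊕ ((+ j) · e w))      ≡⟨ coord-⊕·e-same w p (+ j) ⟩
      coord w p + + j                  ≡⟨ cong (_+ + j) (trans (All.lookup onPlane p∈D) (sym q-on)) ⟩
      coord w q + + j                  ≡⟨ coord-⊕·e-same w q (+ j) ⟨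
      coord w (q ⊕ ((+ j) · e w))      ≡⟨ coord-⊕·u-⊥ _ (+ suc m) w≢i ⟨
      coord w (shadowCube q j m)       ∎
      where open ≡-Reasoning
    i≡ : coord i c ≡ coord i (shadowCube q j m)
    i≡ = trans (coord-i-from-depth q c) (trans (cong (λ x → σ * x + coord i q) (trans depth≡ (sym (depth-shadowCube q j m))))
      (sym (coord-i-from-depth q (shadowCube q j m))))
    a≡ : coord a c ≡ coord a (shadowCube q j m)
    a≡ = trans (coord-a-from-offset q c) (trans (cong (_+ coord a q) (trans offset≡0 (sym (offset-shadowCube q j m))))
      (sym (coord-a-from-offset q (shadowCube q j m))))

  Meets⇔meetsShadow : ∀ {q d} → coord w q ≡ k → d ∈ t → Meets u (Column w q N) d ⇔ T (meetsShadow q d)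
  Meets⇔meetsShadow {q} {d} q-on d∈ = mk⇔ to from
    where
    to : Meets u (Column w q N) d → T (meetsShadow q d)
    to (here in-base)        = Equivalence.from T-∨ (inj₁ (InS⇒inShadow in-base))
    to (there (here in-top)) = Equivalence.from T-∨ (inj₂ (InS⇒inShadow in-top))
    from : T (meetsShadow q d) → Meets u (Column w q N) d
    from meets with Equivalence.to T-∨ meets
    ... | inj₁ base-in = here (inShadow⇒InS q-on (base∈cubesOf d∈) base-in)
    ... | inj₂ top-in  = there (here (inShadow⇒InS q-on (top∈cubesOf d∈) top-in))

  SumOver-shadowSum : ∀ {q} → coord w q ≡ k → SumOver (Meets u (Column w q N)) weight t (shadowSum q)
  SumOver-shadowSum q-on = SumOver-𝟙 (meetsShadow _) t (Meets⇔meetsShadow q-on)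

lemma6p3 : (w : Axis) (k : ℤ) (D : List ℤ³) (N : ℕ) →
           All (λ p → coord w p ≡ k) D →
           ConnectedInterior w D →
           SimplyConnected w k D →
           2 ∣ N →
           (q : ℤ³) → coord w q ≡ k → q ∉ D →
           (t : List Domino) → Tiling (Cylinder w D N) t →
           (u : Dir) →
           SumOver (Meets u (Column w q N)) (λ d → det (v d) (e w) (vec u)) t 0ℤ
lemma6p3 w k D N onPlane _ simplyConnected 2∣N q q-on q∉D t tiling (dir i s) with i ≟ₐ w
... | yes refl = SumOver-none t (not-Meets-vertical s q-on q∉D)
  where open CylinderTiling {w = w} {N = N} {t = t} onPlane tiling
... | no i≢w =
  let f , (f-on , f∉D) , f-vanishes = far-square q-on
  in subst (SumOver (Meets u (Column w q N)) weight t)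
           (trans (shadowSum-path (simplyConnected q f q-on f-on q∉D f∉D) q-on) f-vanishes)
           (SumOver-shadowSum q-on)
  where open Shadow (frame i≢w) s {N = N} {t = t} onPlane (even⇒¬odd 2∣N) tiling
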